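{- Let $q$ be a prime power, $r\geq 1$, and let $\tau$ be a permutation of $F_q^r$ with $\tau({\bf 0})={\bf 0}$. For each $a\in F_q^r$ choose $x_a\in C_a$ and let $y_a=e_{\bf 0}-e_a$. Let $z_1,\dots,z_{\dim C}$ be a basis of $C$ (where $\dim C=\frac{q^r-1}{q-1}-r$), and let $v_1,\dots,v_l$ be vectors completing a basis of $D\cap\tau(D)$ to a basis of $D$ (so $l=\dim D-\dim(D\cap\tau(D))$). Define $$B=\{(x_a|y_{\tau(a)}):a\in F_q^r\setminus\{{\bf 0}\}\},\quad B'=\{(z_i|{\bf 0}):1\le i\le \dim C\},\quad B''=\{({\bf 0}|v_j):1\le j\le l\}.$$ Then the set $B\cup B'\cup B''$ is linearly independent over $F_q$.
   Context: Let $n=\frac{q^r-1}{q-1}$. Let $H_C$ be an $r\times n$ matrix over $F_q$ whose columns are representatives of the $n$ distinct one-dimensional subspaces of $F_q^r$, $C=\{x\in F_q^n: H_Cx^T={\bf 0}\}$ (the $q$-ary Hamming code), and for $a\in F_q^r$, $C_a=\{x\in F_q^n: H_Cx^T=a\}$. Let $D$ be the linear code of length $q^r$ with coordinate positions indexed by vectors of $F_q^r$, $D=\{y=(y_a)_{a\in F_q^r}: \sum_a y_a=0,\ \sum_a y_a a={\bf 0}\}$. $e_a$ denotes the length-$q^r$ vector with $1$ in position $a$ and $0$ elsewhere. A permutation $\tau$ of $F_q^r$ acts on vectors of length $q^r$ by permuting positions, $\tau(e_a)=e_{\tau(a)}$ extended linearly, and $\tau(D)=\{\tau(y):y\in D\}$.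 $(x|y)$ denotes concatenation of $x\in F_q^n$ and $y\in F_q^{q^r}$. -}

module Defs where

open import Level using (Level; _⊔_)
open import Data.Nat using (ℕ; zero; suc)
open import Data.Fin using (Fin)
open import Data.Fin.Properties using (_≟_)
open import Data.Vec using (Vec; []; _∷_)
open import Data.Vec.Properties using (≡-dec)
open import Data.List using (List; []; _∷_; map; concatMap; allFin; filter; foldr; _++_)
open import Data.List.Membership.Propositional using (_∈_)
open import Data.Sum using (_⊎_; inj₁; inj₂)
open import Data.Product using (Σ; ∃; _×_; _,_)
open import Relation.Nullary using (¬_; yes; no; ¬?)
open import Relation.Binary.PropositionalEquality using (_≡_; _≢_)
open import Function.Bundles using (_↔_; Inverse)
open import Algebra.Bundles using (CommutativeRing)
import Data.Vec.Functional as VF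

IsField : ∀ {c ℓ} → CommutativeRing c ℓ → Set (c ⊔ ℓ)
IsField R = (¬ (1# ≈ 0#)) × (∀ x → ¬ (x ≈ 0#) → ∃ λ y → x * y ≈ 1#)
  where open CommutativeRing R

IsEnumeration : ∀ {c ℓ} (R : CommutativeRing c ℓ) (q : ℕ) →
                (Fin q → CommutativeRing.Carrier R) → Set (c ⊔ ℓ)
IsEnumeration R q enum =
  (∀ i j → enum i ≈ enum j → i ≡ j) × (∀ x → ∃ λ i → enum i ≈ x)
  where open CommutativeRing R

allVecs : (q r : ℕ) → List (Vec (Fin q) r)
allVecs q zero = [] ∷ []
allVecs q (suc r) = concatMap (λ c → map (c ∷_) (allVecs q r)) (allFin q)

module _ {c ℓ} (R : CommutativeRing c ℓ) (q : ℕ) (enum : Fin q → CommutativeRing.Carrier R) where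
  open CommutativeRing R

  sumL : ∀ {a} {J : Set a} → List J → (J → Carrier) → Carrier
  sumL js f = foldr (λ j s → f j + s) 0# js

  -- Points of F_q^r are coded by Vec (Fin q) r; the actual vector in F_q^r:
  vecOf : ∀ {r} → Vec (Fin q) r → Fin r → Carrier
  vecOf a i = enum (Data.Vec.lookup a i)

  IsZeroPt : ∀ {r} → Vec (Fin q) r → Set ℓ
  IsZeroPt a = ∀ i → vecOf a i ≈ 0#

  LinIndep : ∀ {a b} {J : Set a} {I : Set b} → List J → (J → I → Carrier) → Set (a ⊔ b ⊔ c ⊔ ℓ)
  LinIndep {J = J} js f =
    ∀ (coef : J → Carrier) →
      (∀ i → sumL js (λ j → coef j * f j i) ≈ 0#) →
      ∀ j → j ∈ js → coef j ≈ 0#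

  Spans : ∀ {a b p} {J : Set a} {I : Set b} → ((I → Carrier) → Set p) →
          List J → (J → I → Carrier) → Set (a ⊔ b ⊔ c ⊔ ℓ ⊔ p)
  Spans {J = J} S js f =
    ∀ x → S x → ∃ λ (coef : J → Carrier) → ∀ i → x i ≈ sumL js (λ j → coef j * f j i)

  IsBasis : ∀ {b p} {I : Set b} {m : ℕ} → ((I → Carrier) → Set p) →
            (Fin m → I → Carrier) → Set (b ⊔ c ⊔ ℓ ⊔ p)
  IsBasis {m = m} S f = (∀ j → S (f j)) × LinIndep (allFin m) f × Spans S (allFin m) f

  module _ (r : ℕ) where
    Pt : Set
    Pt = Vec (Fin q) r

    InD : (Pt → Carrier) → Set ℓ
    InD y = (sumL (allVecs q r) y ≈ 0#)
          × (∀ i → sumL (allVecs q r) (λ a → y a * vecOf a i) ≈ 0#)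

    -- action of a permutation τ on vectors of length q^r: τ(e_a) = e_{τ(a)},
    -- i.e. τ(y)_b = y_{τ⁻¹(b)}
    act : (Pt ↔ Pt) → (Pt → Carrier) → (Pt → Carrier)
    act τ y b = y (Inverse.from τ b)

    InτD : (Pt ↔ Pt) → (Pt → Carrier) → Set (c ⊔ ℓ)
    InτD τ y = ∃ λ y' → InD y' × (∀ b → y b ≈ act τ y' b)

    e : Pt → Pt → Carrier
    e a b with ≡-dec _≟_ a b
    ... | yes _ = 1#
    ... | no _ = 0#

    -- nonzero points (o is the zero point)
    nonzeroPts : Pt → List Pt
    nonzeroPts o = filter (λ a → ¬? (≡-dec _≟_ a o)) (allVecs q r)

    module _ (n : ℕ) (H : Fin r → Fin n → Carrier) where
      -- H's columns are representatives of the distinct one-dimensional subspaces of F_q^r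
      IsHammingMatrix : Set (c ⊔ ℓ)
      IsHammingMatrix =
          (∀ j → ¬ (∀ i → H i j ≈ 0#))
        × (∀ j k → j ≢ k → ¬ (∃ λ s → ∀ i → H i k ≈ s * H i j))
        × (∀ (v : Fin r → Carrier) → ¬ (∀ i → v i ≈ 0#) → ∃ λ j → ∃ λ s → ∀ i → v i ≈ s * H i j)

      syndrome : (Fin n → Carrier) → Fin r → Carrier
      syndrome x i = sumL (allFin n) (λ j → H i j * x j)

      InCa : (Fin r → Carrier) → (Fin n → Carrier) → Set ℓ
      InCa a x = ∀ i → syndrome x i ≈ a i

      InC : (Fin n → Carrier) → Set ℓ
      InC x = ∀ i → syndrome x i ≈ 0#

    concat : ∀ {n} → (Fin n → Carrier) → (Pt → Carrier) → (Fin n ⊎ Pt) → Carrier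
    concat x y (inj₁ j) = x j
    concat x y (inj₂ a) = y a

    zeroV : ∀ {b} {I : Set b} → I → Carrier
    zeroV _ = 0#

    yv : Pt → Pt → Pt → Carrier
    yv o b p = e o p - e b p

    -- the family B ∪ B' ∪ B'':
    --   inj₁ a          ↦ (x_a | y_{τ(a)})   (a ≠ 0)
    --   inj₂ (inj₁ i)   ↦ (z_i | 0)
    --   inj₂ (inj₂ j)   ↦ (0 | v_j)
    family : ∀ {n k l} → (Pt ↔ Pt) → Pt → (Pt → Fin n → Carrier) →
             (Fin k → Fin n → Carrier) → (Fin l → Pt → Carrier) →
             (Pt ⊎ (Fin k ⊎ Fin l)) → (Fin n ⊎ Pt) → Carrier
    family τ o x z v (inj₁ a) = concat (x a) (yv o (Inverse.to τ a))
    family τ o x z v (inj₂ (inj₁ i)) = concat (z i) zeroV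
    family τ o x z v (inj₂ (inj₂ j)) = concat zeroV (v j)

    familyIndex : ∀ (k l : ℕ) → Pt → List (Pt ⊎ (Fin k ⊎ Fin l))
    familyIndex k l o = map inj₁ (nonzeroPts o)
                     ++ map (λ i → inj₂ (inj₁ i)) (allFin k)
                     ++ map (λ j → inj₂ (inj₂ j)) (allFin l)

{-# OPTIONS --safe #-}
-- Let Σ α_a (x_a | y_τa) + Σ β_i (z_i | 0) + Σ γ_j (0 | v_j) = 0. Applying H to the first component gives
-- Σ α_a a = 0, so u = Σ α_a y_a lies in D and s = τ(u) = Σ α_a y_τa lies in τ(D). The second component
-- says s = −Σ γ_j v_j ∈ D, so s ∈ D ∩ τ(D) is a combination of the basis w; independence of w ++ v forces
-- γ = 0 and hence s = 0. As τa ≠ 0 for a ≠ 0, the τa-coordinate of s is −α_a, so α = 0, and then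
-- Σ β_i z_i = 0 gives β = 0.
module Submission where

open import Defs
open import Level using (Level)
open import Data.Nat using (ℕ; _≤_; zero; suc)
import Data.Nat as Nat
open import Data.Fin as Fin using (Fin; _↑ˡ_; _↑ʳ_)
open import Data.Fin.Properties using (_≟_)
open import Data.Product using (Σ; ∃; _×_; _,_; proj₁; proj₂)
open import Data.Sum using (_⊎_; inj₁; inj₂)
open import Data.Vec using (Vec; []; _∷_)
open import Data.Vec.Properties using (≡-dec; ∷-injectiveˡ; ∷-injectiveʳ)
open import Data.Vec.Functional using (_++_)
open import Data.Vec.Functional.Properties using (lookup-++ˡ; lookup-++ʳ)
open import Data.List as List using (List; []; _∷_; allFin; concatMap; cartesianProductWith)
open import Data.List.Membership.Propositional using (_∈_)
open import Data.List.Membership.Propositional.Properties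
  using (∈-allFin; ∈-cartesianProductWith⁺; ∈-filter⁻; ∈-++⁻; ∈-map⁻)
open import Data.List.Relation.Unary.Any using (here; there)
import Data.List.Relation.Unary.All as All
open import Data.List.Relation.Unary.AllPairs using ([]; _∷_)
open import Data.List.Relation.Unary.Unique.Propositional using (Unique)
import Data.List.Relation.Unary.Unique.Propositional.Properties as Unique
open import Data.Empty using (⊥-elim)
open import Relation.Nullary using (yes; no; ¬?)
open import Relation.Binary.PropositionalEquality as ≡ using (_≡_; _≢_)
open import Function using (_∘_; id)
open import Function.Bundles using (_↔_; Inverse; Injection)
open import Function.Properties.Inverse using (↔⇒↣)
open import Algebra.Bundles using (CommutativeRing)

concatMap-map≡cartesianProductWith :
  ∀ {a b c} {A : Set a} {B : Set b} {C : Set c} (f : A → B → C) (xs : List A) (ys : List B) →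
  concatMap (λ x → List.map (f x) ys) xs ≡ cartesianProductWith f xs ys
concatMap-map≡cartesianProductWith f []       ys = ≡.refl
concatMap-map≡cartesianProductWith f (x ∷ xs) ys =
  ≡.cong (List.map (f x) ys List.++_) (concatMap-map≡cartesianProductWith f xs ys)

allVecs-unique : ∀ q r → Unique (allVecs q r)
allVecs-unique q zero    = All.[] ∷ []
allVecs-unique q (suc r) =
  ≡.subst Unique (≡.sym (concatMap-map≡cartesianProductWith _∷_ (allFin q) (allVecs q r)))
    (Unique.cartesianProductWith⁺ _∷_ (λ eq → ∷-injectiveˡ eq , ∷-injectiveʳ eq)
      (Unique.allFin⁺ q) (allVecs-unique q r))

∈-allVecs : ∀ q r (a : Vec (Fin q) r) → a ∈ allVecs q r
∈-allVecs q zero    []      = here ≡.refl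
∈-allVecs q (suc r) (i ∷ a) =
  ≡.subst (i ∷ a ∈_) (≡.sym (concatMap-map≡cartesianProductWith _∷_ (allFin q) (allVecs q r)))
    (∈-cartesianProductWith⁺ _∷_ (∈-allFin i) (∈-allVecs q r a))

module LinearCombinations {c ℓ} (R : CommutativeRing c ℓ) where
  open CommutativeRing R
  open import Algebra.Properties.Ring ring using (-0#≈0#; -‿+-comm; -‿distribˡ-*)
  open import Algebra.Properties.CommutativeSemigroup +-commutativeSemigroup using (interchange)
  open import Algebra.Properties.CommutativeSemigroup *-commutativeSemigroup using (x∙yz≈y∙xz)

  private variable
    ℓ₁ ℓ₂ : Level
    J : Set ℓ₁
    I : Set ℓ₂

  sum : List J → (J → Carrier) → Carrier
  sum js f = List.foldr (λ j s → f j + s) 0# js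

  linComb : List J → (J → Carrier) → (J → I → Carrier) → I → Carrier
  linComb js α f i = sum js (λ j → α j * f j i)

  sum-cong : (js : List J) {f g : J → Carrier} → (∀ j → j ∈ js → f j ≈ g j) → sum js f ≈ sum js g
  sum-cong []       f≈g = refl
  sum-cong (j ∷ js) f≈g = +-cong (f≈g j (here ≡.refl)) (sum-cong js (λ j′ → f≈g j′ ∘ there))

  sum-zero : (js : List J) {f : J → Carrier} → (∀ j → j ∈ js → f j ≈ 0#) → sum js f ≈ 0#
  sum-zero js f≈0 = trans (sum-cong js f≈0) (sum-zero′ js)
    where
    sum-zero′ : (js : List J) → sum js (λ _ → 0#) ≈ 0#
    sum-zero′ []       = refl
    sum-zero′ (_ ∷ js) = trans (+-congˡ (sum-zero′ js)) (+-identityʳ 0#)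

  sum-+ : (js : List J) (f g : J → Carrier) → sum js (λ j → f j + g j) ≈ sum js f + sum js g
  sum-+ []       f g = sym (+-identityʳ 0#)
  sum-+ (j ∷ js) f g = trans (+-congˡ (sum-+ js f g)) (interchange (f j) (g j) (sum js f) (sum js g))

  sum-*ˡ : (js : List J) (x : Carrier) (f : J → Carrier) → sum js (λ j → x * f j) ≈ x * sum js f
  sum-*ˡ []       x f = sym (zeroʳ x)
  sum-*ˡ (j ∷ js) x f = trans (+-congˡ (sum-*ˡ js x f)) (sym (distribˡ x (f j) (sum js f)))

  sum-*ʳ : (js : List J) (f : J → Carrier) (x : Carrier) → sum js (λ j → f j * x) ≈ sum js f * x
  sum-*ʳ js f x = trans (sum-cong js (λ j _ → *-comm (f j) x)) (trans (sum-*ˡ js x f) (*-comm x _))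

  sum-neg : (js : List J) (f : J → Carrier) → sum js (λ j → - f j) ≈ - sum js f
  sum-neg []       f = sym -0#≈0#
  sum-neg (j ∷ js) f = trans (+-congˡ (sum-neg js f)) (-‿+-comm (f j) (sum js f))

  sum-- : (js : List J) (f g : J → Carrier) → sum js (λ j → f j - g j) ≈ sum js f - sum js g
  sum-- js f g = trans (sum-+ js f (λ j → - g j)) (+-congˡ (sum-neg js g))

  sum-swap : (js : List J) (is : List I) (f : J → I → Carrier) →
             sum js (λ j → sum is (f j)) ≈ sum is (λ i → sum js (λ j → f j i))
  sum-swap []       is f = sym (sum-zero is (λ _ _ → refl))
  sum-swap (j ∷ js) is f =
    trans (+-congˡ (sum-swap js is f)) (sym (sum-+ is (f j) (λ i → sum js (λ j′ → f j′ i))))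

  sum-++ : (xs ys : List J) (f : J → Carrier) → sum (xs List.++ ys) f ≈ sum xs f + sum ys f
  sum-++ []       ys f = sym (+-identityˡ _)
  sum-++ (x ∷ xs) ys f = trans (+-congˡ (sum-++ xs ys f)) (sym (+-assoc _ _ _))

  sum-map : (g : I → J) (xs : List I) (f : J → Carrier) → sum (List.map g xs) f ≡ sum xs (f ∘ g)
  sum-map g []       f = ≡.refl
  sum-map g (x ∷ xs) f = ≡.cong (f (g x) +_) (sum-map g xs f)

  sum-unique-single : (js : List J) {j : J} (f : J → Carrier) → Unique js → j ∈ js →
                      (∀ j′ → j′ ∈ js → j′ ≢ j → f j′ ≈ 0#) → sum js f ≈ f j
  sum-unique-single (j ∷ js) f (j∉js ∷ _) (here ≡.refl) others≈0 =
    trans (+-congˡ (sum-zero js (λ j′ j′∈js → others≈0 j′ (there j′∈js) (All.lookup j∉js j′∈js ∘ ≡.sym))))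
          (+-identityʳ _)
  sum-unique-single (j′ ∷ js) f (j′∉js ∷ js-unique) (there j∈js) others≈0 =
    trans (+-cong (others≈0 j′ (here ≡.refl) (All.lookup j′∉js j∈js))
                  (sum-unique-single js f js-unique j∈js (λ j″ → others≈0 j″ ∘ there)))
          (+-identityˡ _)

  sum-tabulate : ∀ {n} (g : Fin n → J) (f : J → Carrier) → sum (List.tabulate g) f ≡ sum (allFin n) (f ∘ g)
  sum-tabulate {n = zero}  g f = ≡.refl
  sum-tabulate {n = suc n} g f =
    ≡.cong (f (g Fin.zero) +_) (≡.trans (sum-tabulate (g ∘ Fin.suc) f) (≡.sym (sum-tabulate Fin.suc (f ∘ g))))

  sum-tabulate-+ : ∀ m {l} (g : Fin (m Nat.+ l) → J) (f : J → Carrier) →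
                   sum (List.tabulate g) f ≈ sum (List.tabulate (g ∘ (_↑ˡ l))) f + sum (List.tabulate (g ∘ (m ↑ʳ_))) f
  sum-tabulate-+ zero    g f = sym (+-identityˡ _)
  sum-tabulate-+ (suc m) g f = trans (+-congˡ (sum-tabulate-+ m (g ∘ Fin.suc) f)) (sym (+-assoc _ _ _))

  sum-allFin-+ : ∀ m {l} (f : Fin (m Nat.+ l) → Carrier) →
                 sum (allFin (m Nat.+ l)) f ≈ sum (allFin m) (f ∘ (_↑ˡ l)) + sum (allFin l) (f ∘ (m ↑ʳ_))
  sum-allFin-+ m {l} f = trans (sum-tabulate-+ m id f)
    (+-cong (reflexive (sum-tabulate (_↑ˡ l) f)) (reflexive (sum-tabulate (m ↑ʳ_) f)))

  linComb-*ˡ : (js : List J) (α : J → Carrier) (f : J → I → Carrier) (x : Carrier) (i : I) →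
               x * linComb js α f i ≈ linComb js α (λ j i → x * f j i) i
  linComb-*ˡ js α f x i = trans (sym (sum-*ˡ js x _)) (sum-cong js (λ j _ → x∙yz≈y∙xz x (α j) (f j i)))

  linComb-*ʳ : (js : List J) (α : J → Carrier) (f : J → I → Carrier) (x : Carrier) (i : I) →
               linComb js α f i * x ≈ linComb js α (λ j i → f j i * x) i
  linComb-*ʳ js α f x i = trans (sym (sum-*ʳ js _ x)) (sum-cong js (λ j _ → *-assoc (α j) (f j i) x))

  sum-linComb : (is : List I) (js : List J) (α : J → Carrier) (f : J → I → Carrier) →
                sum is (linComb js α f) ≈ sum js (λ j → α j * sum is (f j))
  sum-linComb is js α f =
    trans (sym (sum-swap js is (λ j i → α j * f j i))) (sum-cong js (λ j _ → sum-*ˡ is (α j) (f j)))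

  sum-*ˡ-linComb : (is : List I) (js : List J) (α : J → Carrier) (f : J → I → Carrier) (h : I → Carrier) →
                   sum is (λ i → h i * linComb js α f i) ≈ sum js (λ j → α j * sum is (λ i → h i * f j i))
  sum-*ˡ-linComb is js α f h =
    trans (sum-cong is (λ i _ → linComb-*ˡ js α f (h i) i)) (sum-linComb is js α (λ j i → h i * f j i))

  sum-linComb-*ʳ : (is : List I) (js : List J) (α : J → Carrier) (f : J → I → Carrier) (h : I → Carrier) →
                   sum is (λ i → linComb js α f i * h i) ≈ sum js (λ j → α j * sum is (λ i → f j i * h i))
  sum-linComb-*ʳ is js α f h =
    trans (sum-cong is (λ i _ → linComb-*ʳ js α f (h i) i)) (sum-linComb is js α (λ j i → f j i * h i))

  linComb-neg : (js : List J) (α : J → Carrier) (f : J → I → Carrier) (i : I) →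
                - linComb js α f i ≈ linComb js (λ j → - α j) f i
  linComb-neg js α f i = trans (sym (sum-neg js _)) (sum-cong js (λ j _ → -‿distribˡ-* (α j) (f j i)))

  linComb-zeroˡ : (js : List J) {α : J → Carrier} (f : J → I → Carrier) (i : I) →
                  (∀ j → j ∈ js → α j ≈ 0#) → linComb js α f i ≈ 0#
  linComb-zeroˡ js f i α≈0 = sum-zero js (λ j j∈js → trans (*-congʳ (α≈0 j j∈js)) (zeroˡ (f j i)))

  linComb-zeroʳ : (js : List J) (α : J → Carrier) (f : J → I → Carrier) (i : I) →
                  (∀ j → j ∈ js → f j i ≈ 0#) → linComb js α f i ≈ 0#
  linComb-zeroʳ js α f i f≈0 = sum-zero js (λ j j∈js → trans (*-congˡ (f≈0 j j∈js)) (zeroʳ (α j)))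

  linComb-++ : ∀ m {l} (α : Fin m → Carrier) (β : Fin l → Carrier)
               (f : Fin m → I → Carrier) (g : Fin l → I → Carrier) (i : I) →
               linComb (allFin (m Nat.+ l)) (α ++ β) (f ++ g) i
               ≈ linComb (allFin m) α f i + linComb (allFin l) β g i
  linComb-++ m {l} α β f g i = trans (sum-allFin-+ m (λ t → (α ++ β) t * (f ++ g) t i))
    (+-cong (sum-cong (allFin m) (λ t _ → reflexive (≡.cong₂ (λ a h → a * h i) (lookup-++ˡ α β t) (lookup-++ˡ f g t))))
            (sum-cong (allFin l) (λ t _ → reflexive (≡.cong₂ (λ a h → a * h i) (lookup-++ʳ α β t) (lookup-++ʳ f g t)))))

  x≈0∧x+y≈0⇒y≈0 : ∀ {x y} → x ≈ 0# → x + y ≈ 0# → y ≈ 0#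
  x≈0∧x+y≈0⇒y≈0 {x} {y} x≈0 x+y≈0 = trans (sym (trans (+-congʳ x≈0) (+-identityˡ y))) x+y≈0

lookup-++ʳ-all : ∀ {a p} {A : Set a} {m l} {f : Fin m → A} {g : Fin l → A} (P : A → Set p) →
                 (∀ t → P ((f ++ g) t)) → ∀ j → P (g j)
lookup-++ʳ-all {m = m} {f = f} {g} P all-P j = ≡.subst P (lookup-++ʳ f g j) (all-P (m ↑ʳ j))

module Independence {c ℓ} (R : CommutativeRing c ℓ) (q : ℕ) (enum : Fin q → CommutativeRing.Carrier R) where
  open CommutativeRing R
  open LinearCombinations R

  ++-independent⇒coefʳ≈0 : ∀ {b} {I : Set b} {m l} {f : Fin m → I → Carrier} {g : Fin l → I → Carrier} →
    LinIndep R q enum (allFin (m Nat.+ l)) (f ++ g) → (α : Fin m → Carrier) (β : Fin l → Carrier) →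
    (∀ i → linComb (allFin m) α f i + linComb (allFin l) β g i ≈ 0#) → ∀ j → β j ≈ 0#
  ++-independent⇒coefʳ≈0 {m = m} {f = f} {g} independent α β α+β≈0 j =
    trans (reflexive (≡.sym (lookup-++ʳ α β j)))
          (independent (α ++ β) (λ i → trans (linComb-++ m α β f g i) (α+β≈0 i)) (m ↑ʳ j) (∈-allFin _))

module Code {c ℓ} (R : CommutativeRing c ℓ) (q : ℕ) (enum : Fin q → CommutativeRing.Carrier R) (r : ℕ) where
  open CommutativeRing R
  open LinearCombinations R
  open import Algebra.Properties.Ring ring using (-0#≈0#; -‿distribʳ-*; [y-z]x≈yx-zx)
  open import Relation.Binary.Reasoning.Setoid setoid

  private
    Point : Set
    Point = Pt R q enum r

    points : List Point
    points = allVecs q r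

  e-diag : ∀ a → e R q enum r a a ≈ 1#
  e-diag a with ≡-dec _≟_ a a
  ... | yes _  = refl
  ... | no a≢a = ⊥-elim (a≢a ≡.refl)

  e-offdiag : ∀ {a b} → a ≢ b → e R q enum r a b ≈ 0#
  e-offdiag {a} {b} a≢b with ≡-dec _≟_ a b
  ... | yes a≡b = ⊥-elim (a≢b a≡b)
  ... | no _    = refl

  e-from : (τ : Point ↔ Point) → ∀ a b → e R q enum r a (Inverse.from τ b) ≡ e R q enum r (Inverse.to τ a) b
  e-from τ a b with ≡-dec _≟_ a (Inverse.from τ b) | ≡-dec _≟_ (Inverse.to τ a) b
  ... | yes _    | yes _    = ≡.refl
  ... | no _     | no _     = ≡.refl
  ... | yes a≡τ⁻¹b | no τa≢b =
    ⊥-elim (τa≢b (≡.trans (≡.cong (Inverse.to τ) a≡τ⁻¹b) (Inverse.strictlyInverseˡ τ b)))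
  ... | no a≢τ⁻¹b | yes τa≡b =
    ⊥-elim (a≢τ⁻¹b (≡.trans (≡.sym (Inverse.strictlyInverseʳ τ a)) (≡.cong (Inverse.from τ) τa≡b)))

  sum-e-* : ∀ a (g : Point → Carrier) → sum points (λ b → e R q enum r a b * g b) ≈ g a
  sum-e-* a g =
    trans (sum-unique-single points _ (allVecs-unique q r) (∈-allVecs q r a)
             (λ b _ b≢a → trans (*-congʳ (e-offdiag (b≢a ∘ ≡.sym))) (zeroˡ (g b))))
          (trans (*-congʳ (e-diag a)) (*-identityˡ (g a)))

  sum-yv-* : ∀ o a (g : Point → Carrier) → sum points (λ b → yv R q enum r o a b * g b) ≈ g o - g a
  sum-yv-* o a g = begin
    sum points (λ b → (e′ o b - e′ a b) * g b)       ≈⟨ sum-cong points (λ b _ → [y-z]x≈yx-zx (g b) _ _) ⟩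
    sum points (λ b → e′ o b * g b - e′ a b * g b)   ≈⟨ sum-- points _ _ ⟩
    sum points (λ b → e′ o b * g b) - sum points (λ b → e′ a b * g b) ≈⟨ +-cong (sum-e-* o g) (-‿cong (sum-e-* a g)) ⟩
    g o - g a                                         ∎
    where
    e′ : Point → Point → Carrier
    e′ = e R q enum r

  sum-yv : ∀ o a → sum points (yv R q enum r o a) ≈ 0#
  sum-yv o a = trans (sum-cong points (λ b _ → sym (*-identityʳ _)))
                     (trans (sum-yv-* o a (λ _ → 1#)) (-‿inverseʳ 1#))

  InD-cong : ∀ {y y′ : Point → Carrier} → (∀ b → y b ≈ y′ b) → InD R q enum r y → InD R q enum r y′
  InD-cong y≈y′ (Σy≈0 , Σyb≈0) =
      trans (sym (sum-cong points (λ b _ → y≈y′ b))) Σy≈0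
    , λ i → trans (sym (sum-cong points (λ b _ → *-congʳ (y≈y′ b)))) (Σyb≈0 i)

  InD-linComb : ∀ {a} {J : Set a} (js : List J) (α : J → Carrier) (f : J → Point → Carrier) →
                (∀ j → InD R q enum r (f j)) → InD R q enum r (linComb js α f)
  InD-linComb js α f f∈D =
      trans (sum-linComb points js α f) (sum-zero js (λ j _ → trans (*-congˡ (proj₁ (f∈D j))) (zeroʳ (α j))))
    , λ i → trans (sum-linComb-*ʳ points js α f (λ b → vecOf R q enum b i))
                  (sum-zero js (λ j _ → trans (*-congˡ (proj₂ (f∈D j) i)) (zeroʳ (α j))))

  -- Σ_b (e₀ − e_a)_b · b = −a, so Σ α_a y_a satisfies the second parity check of D iff Σ α_a a = 0.
  InD-linComb-yv : (js : List Point) (α : Point → Carrier) {o : Point} → IsZeroPt R q enum o →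
                   (∀ i → linComb js α (vecOf R q enum) i ≈ 0#) → InD R q enum r (linComb js α (yv R q enum r o))
  InD-linComb-yv js α {o} o≈0 Σαa≈0 =
      trans (sum-linComb points js α _) (sum-zero js (λ a _ → trans (*-congˡ (sum-yv o a)) (zeroʳ (α a))))
    , λ i → begin
        sum points (λ b → linComb js α (yv R q enum r o) b * vec b i)
          ≈⟨ sum-linComb-*ʳ points js α _ (λ b → vec b i) ⟩
        sum js (λ a → α a * sum points (λ b → yv R q enum r o a b * vec b i))
          ≈⟨ sum-cong js (λ a _ → *-congˡ (trans (sum-yv-* o a (λ b → vec b i)) (+-congʳ (o≈0 i)))) ⟩
        sum js (λ a → α a * (0# - vec a i))
          ≈⟨ sum-cong js (λ a _ → trans (*-congˡ (+-identityˡ _)) (sym (-‿distribʳ-* (α a) (vec a i)))) ⟩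
        sum js (λ a → - (α a * vec a i))   ≈⟨ sum-neg js _ ⟩
        - linComb js α (vecOf R q enum) i  ≈⟨ -‿cong (Σαa≈0 i) ⟩
        - 0#                               ≈⟨ -0#≈0# ⟩
        0#                                 ∎
    where
    vec : Point → Fin r → Carrier
    vec = vecOf R q enum

  InτD-linComb-yv : (τ : Point ↔ Point) {o : Point} → Inverse.to τ o ≡ o → (js : List Point) (α : Point → Carrier) →
                    InD R q enum r (linComb js α (yv R q enum r o)) →
                    InτD R q enum r τ (linComb js α (λ a → yv R q enum r o (Inverse.to τ a)))
  InτD-linComb-yv τ {o} τo≡o js α u∈D =
    linComb js α (yv R q enum r o) , u∈D , λ b → sum-cong js (λ a _ → *-congˡ (reflexive (≡.sym (act-yv a b))))
    where
    act-yv : ∀ a b → act R q enum r τ (yv R q enum r o a) b ≡ yv R q enum r o (Inverse.to τ a) b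
    act-yv a b = ≡.cong₂ _-_ (≡.trans (e-from τ o b) (≡.cong (λ t → e R q enum r t b) τo≡o)) (e-from τ a b)

  linComb-yv-at : ∀ {a} {J : Set a} (js : List J) (α : J → Carrier) (g : J → Point) {o : Point} {j : J} →
                  Unique js → j ∈ js → (∀ {j′} → g j′ ≡ g j → j′ ≡ j) → g j ≢ o →
                  linComb js α (λ j′ → yv R q enum r o (g j′)) (g j) ≈ - α j
  linComb-yv-at js α g {o} {j} unique j∈js g-injective gj≢o = begin
    linComb js α (λ j′ → yv R q enum r o (g j′)) (g j)
      ≈⟨ sum-unique-single js _ unique j∈js (λ j′ _ j′≢j → trans (*-congˡ (yv-offdiag (j′≢j ∘ g-injective))) (zeroʳ (α j′))) ⟩
    α j * (e′ o (g j) - e′ (g j) (g j))   ≈⟨ *-congˡ (+-cong (e-offdiag (gj≢o ∘ ≡.sym)) (-‿cong (e-diag (g j)))) ⟩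
    α j * (0# - 1#)                       ≈⟨ *-congˡ (+-identityˡ (- 1#)) ⟩
    α j * - 1#                            ≈⟨ sym (-‿distribʳ-* (α j) 1#) ⟩
    - (α j * 1#)                          ≈⟨ -‿cong (*-identityʳ (α j)) ⟩
    - α j                                 ∎
    where
    e′ : Point → Point → Carrier
    e′ = e R q enum r

    yv-offdiag : ∀ {b} → g b ≢ g j → yv R q enum r o (g b) (g j) ≈ 0#
    yv-offdiag gb≢gj = trans (+-cong (e-offdiag (gj≢o ∘ ≡.sym)) (-‿cong (e-offdiag gb≢gj))) (-‿inverseʳ 0#)

  nonzeroPts-unique : ∀ o → Unique (nonzeroPts R q enum r o)
  nonzeroPts-unique o = Unique.filter⁺ (λ a → ¬? (≡-dec _≟_ a o)) (allVecs-unique q r)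

  ∈-nonzeroPts⇒≢ : ∀ {o a} → a ∈ nonzeroPts R q enum r o → a ≢ o
  ∈-nonzeroPts⇒≢ {o} a∈ = proj₂ (∈-filter⁻ (λ a → ¬? (≡-dec _≟_ a o)) {xs = points} a∈)

  sum-familyIndex : ∀ {k l} o (f : Point ⊎ (Fin k ⊎ Fin l) → Carrier) →
    sum (familyIndex R q enum r k l o) f ≈
    sum (nonzeroPts R q enum r o) (f ∘ inj₁) + (sum (allFin k) (f ∘ inj₂ ∘ inj₁) + sum (allFin l) (f ∘ inj₂ ∘ inj₂))
  sum-familyIndex {k} {l} o f =
    trans (sum-++ (List.map inj₁ (nonzeroPts R q enum r o)) _ f)
      (+-cong (reflexive (sum-map inj₁ (nonzeroPts R q enum r o) f))
        (trans (sum-++ (List.map (inj₂ ∘ inj₁) (allFin k)) _ f)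
          (+-cong (reflexive (sum-map (inj₂ ∘ inj₁) (allFin k) f))
                  (reflexive (sum-map (inj₂ ∘ inj₂) (allFin l) f)))))

  inj₁∈familyIndex⇒∈nonzeroPts : ∀ {k l o a} → inj₁ a ∈ familyIndex R q enum r k l o → a ∈ nonzeroPts R q enum r o
  inj₁∈familyIndex⇒∈nonzeroPts {k} {l} {o} a∈ with ∈-++⁻ (List.map inj₁ (nonzeroPts R q enum r o)) a∈
  ... | inj₁ a∈nz with ∈-map⁻ inj₁ a∈nz
  ...   | _ , a∈ , ≡.refl = a∈
  inj₁∈familyIndex⇒∈nonzeroPts {k} {l} a∈ | inj₂ a∈rest with ∈-++⁻ (List.map (inj₂ {A = Point} ∘ inj₁ {B = Fin l}) (allFin k)) a∈rest
  ... | inj₁ a∈k with ∈-map⁻ (inj₂ {A = Point} ∘ inj₁ {B = Fin l}) a∈k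
  ...   | _ , _ , ()
  inj₁∈familyIndex⇒∈nonzeroPts {k} {l} a∈ | inj₂ _ | inj₂ a∈l with ∈-map⁻ (inj₂ {A = Point} ∘ inj₂ {A = Fin k}) a∈l
  ...   | _ , _ , ()

module Syndrome {c ℓ} (R : CommutativeRing c ℓ) (q : ℕ) (enum : Fin q → CommutativeRing.Carrier R)
                (r n : ℕ) (H : Fin r → Fin n → CommutativeRing.Carrier R) where
  open CommutativeRing R
  open LinearCombinations R

  syndrome-linComb : ∀ {a} {J : Set a} (js : List J) (α : J → Carrier) (f : J → Fin n → Carrier) i →
    syndrome R q enum r n H (linComb js α f) i ≈ linComb js α (λ j → syndrome R q enum r n H (f j)) i
  syndrome-linComb js α f i = sum-*ˡ-linComb (allFin n) js α f (H i)

  syndrome-+ : ∀ (x y : Fin n → Carrier) i →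
    syndrome R q enum r n H (λ j → x j + y j) i ≈ syndrome R q enum r n H x i + syndrome R q enum r n H y i
  syndrome-+ x y i = trans (sum-cong (allFin n) (λ j _ → distribˡ (H i j) (x j) (y j))) (sum-+ (allFin n) _ _)

  syndrome-zero : ∀ {x : Fin n → Carrier} → (∀ j → x j ≈ 0#) → ∀ i → syndrome R q enum r n H x i ≈ 0#
  syndrome-zero x≈0 i = sum-zero (allFin n) (λ j _ → trans (*-congˡ (x≈0 j)) (zeroʳ (H i j)))

module Relation {c ℓ} (R : CommutativeRing c ℓ) (q : ℕ) (enum : Fin q → CommutativeRing.Carrier R)
  (r n : ℕ) (H : Fin r → Fin n → CommutativeRing.Carrier R)
  (τ : Pt R q enum r ↔ Pt R q enum r) (o : Pt R q enum r)
  (o≈0 : IsZeroPt R q enum o) (τo≡o : Inverse.to τ o ≡ o)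
  (x : Pt R q enum r → Fin n → CommutativeRing.Carrier R)
  (x∈C : ∀ a → InCa R q enum r n H (vecOf R q enum a) (x a))
  (k : ℕ) (z : Fin k → Fin n → CommutativeRing.Carrier R)
  (z-basis : IsBasis R q enum (InC R q enum r n H) z)
  (l : ℕ) (v : Fin l → Pt R q enum r → CommutativeRing.Carrier R)
  (m : ℕ) (w : Fin m → Pt R q enum r → CommutativeRing.Carrier R)
  (w-basis : IsBasis R q enum (λ y → InD R q enum r y × InτD R q enum r τ y) w)
  (wv-basis : IsBasis R q enum (InD R q enum r) (w ++ v))
  (coef : Pt R q enum r ⊎ (Fin k ⊎ Fin l) → CommutativeRing.Carrier R)
  (relation : ∀ p → CommutativeRing._≈_ R
                      (LinearCombinations.linComb R (familyIndex R q enum r k l o) coef (family R q enum r τ o x z v) p)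
                      (CommutativeRing.0# R)) where
  open CommutativeRing R
  open LinearCombinations R
  open Independence R q enum
  open Code R q enum r
  open Syndrome R q enum r n H
  open import Algebra.Properties.Ring ring using (-0#≈0#; -‿injective; +-inverseˡ-unique)
  open import Relation.Binary.Reasoning.Setoid setoid

  private
    nonzero : List (Pt R q enum r)
    nonzero = nonzeroPts R q enum r o

    to : Pt R q enum r → Pt R q enum r
    to = Inverse.to τ

    fam : Pt R q enum r ⊎ (Fin k ⊎ Fin l) → Fin n ⊎ Pt R q enum r → Carrier
    fam = family R q enum r τ o x z v

  α : Pt R q enum r → Carrier
  α a = coef (inj₁ a)

  β : Fin k → Carrier
  β i = coef (inj₂ (inj₁ i))

  γ : Fin l → Carrier
  γ j = coef (inj₂ (inj₂ j))

  X Z : Fin n → Carrier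
  X = linComb nonzero α x
  Z = linComb (allFin k) β z

  s V : Pt R q enum r → Carrier
  s = linComb nonzero α (λ a → yv R q enum r o (to a))
  V = linComb (allFin l) γ v

  relation-split : ∀ p → linComb nonzero α (fam ∘ inj₁) p
                 + (linComb (allFin k) β (fam ∘ inj₂ ∘ inj₁) p + linComb (allFin l) γ (fam ∘ inj₂ ∘ inj₂) p) ≈ 0#
  relation-split p = trans (sym (sum-familyIndex o _)) (relation p)

  X+Z≈0 : ∀ j → X j + Z j ≈ 0#
  X+Z≈0 j = trans (+-congˡ (sym Z+0≈Z)) (relation-split (inj₁ j))
    where
    Z+0≈Z : Z j + linComb (allFin l) γ (fam ∘ inj₂ ∘ inj₂) (inj₁ j) ≈ Z j
    Z+0≈Z = trans (+-congˡ (linComb-zeroʳ (allFin l) γ (fam ∘ inj₂ ∘ inj₂) (inj₁ j) (λ _ _ → refl))) (+-identityʳ (Z j))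

  s+V≈0 : ∀ b → s b + V b ≈ 0#
  s+V≈0 b = trans (+-congˡ (sym 0+V≈V)) (relation-split (inj₂ b))
    where
    0+V≈V : linComb (allFin k) β (fam ∘ inj₂ ∘ inj₁) (inj₂ b) + V b ≈ V b
    0+V≈V = trans (+-congʳ (linComb-zeroʳ (allFin k) β (fam ∘ inj₂ ∘ inj₁) (inj₂ b) (λ _ _ → refl))) (+-identityˡ (V b))

  Σαa≈0 : ∀ i → linComb nonzero α (vecOf R q enum) i ≈ 0#
  Σαa≈0 i = begin
    linComb nonzero α (vecOf R q enum) i
      ≈⟨ sum-cong nonzero (λ a _ → *-congˡ (sym (x∈C a i))) ⟩
    linComb nonzero α (λ a → syndrome R q enum r n H (x a)) i
      ≈⟨ sym (+-identityʳ _) ⟩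
    linComb nonzero α (λ a → syndrome R q enum r n H (x a)) i + 0#
      ≈⟨ +-congˡ (sym (linComb-zeroʳ (allFin k) β (λ t → syndrome R q enum r n H (z t)) i (λ t _ → proj₁ z-basis t i))) ⟩
    linComb nonzero α (λ a → syndrome R q enum r n H (x a)) i + linComb (allFin k) β (λ t → syndrome R q enum r n H (z t)) i
      ≈⟨ sym (+-cong (syndrome-linComb nonzero α x i) (syndrome-linComb (allFin k) β z i)) ⟩
    syndrome R q enum r n H X i + syndrome R q enum r n H Z i
      ≈⟨ sym (syndrome-+ X Z i) ⟩
    syndrome R q enum r n H (λ j → X j + Z j) i
      ≈⟨ syndrome-zero X+Z≈0 i ⟩
    0# ∎

  s∈τD : InτD R q enum r τ s
  s∈τD = InτD-linComb-yv τ τo≡o nonzero α (InD-linComb-yv nonzero α {o} o≈0 Σαa≈0)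

  s∈D : InD R q enum r s
  s∈D = InD-cong (λ b → sym (s≈−V b)) (InD-linComb (allFin l) (λ j → - γ j) v v∈D)
    where
    v∈D : ∀ j → InD R q enum r (v j)
    v∈D = lookup-++ʳ-all (InD R q enum r) (proj₁ wv-basis)

    s≈−V : ∀ b → s b ≈ linComb (allFin l) (λ j → - γ j) v b
    s≈−V b = trans (+-inverseˡ-unique (s b) (V b) (s+V≈0 b)) (linComb-neg (allFin l) γ v b)

  γ≈0 : ∀ j → γ j ≈ 0#
  γ≈0 = ++-independent⇒coefʳ≈0 (proj₁ (proj₂ wv-basis)) coefʷ γ (λ b → trans (+-congʳ (sym (s≈Σw b))) (s+V≈0 b))
    where
    coefʷ : Fin m → Carrier
    coefʷ = proj₁ (proj₂ (proj₂ w-basis) s (s∈D , s∈τD))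

    s≈Σw : ∀ b → s b ≈ linComb (allFin m) coefʷ w b
    s≈Σw = proj₂ (proj₂ (proj₂ w-basis) s (s∈D , s∈τD))

  α≈0 : ∀ {a} → a ∈ nonzero → α a ≈ 0#
  α≈0 {a} a∈ = -‿injective (begin
    - α a     ≈⟨ sym (linComb-yv-at nonzero α to (nonzeroPts-unique o) a∈ to-injective τa≢o) ⟩
    s (to a)  ≈⟨ s≈0 ⟩
    0#        ≈⟨ sym -0#≈0# ⟩
    - 0#      ∎)
    where
    to-injective : ∀ {a′} → to a′ ≡ to a → a′ ≡ a
    to-injective = Injection.injective (↔⇒↣ τ)
    τa≢o : to a ≢ o
    τa≢o τa≡o = ∈-nonzeroPts⇒≢ a∈ (≡.sym (to-injective (≡.trans τo≡o (≡.sym τa≡o))))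
    s≈0 : s (to a) ≈ 0#
    s≈0 = x≈0∧x+y≈0⇒y≈0 (linComb-zeroˡ (allFin l) v (to a) (λ j _ → γ≈0 j))
                         (trans (+-comm _ _) (s+V≈0 (to a)))

  β≈0 : ∀ i → β i ≈ 0#
  β≈0 i = proj₁ (proj₂ z-basis) β Z≈0 i (∈-allFin i)
    where
    Z≈0 : ∀ j → Z j ≈ 0#
    Z≈0 j = x≈0∧x+y≈0⇒y≈0 (linComb-zeroˡ nonzero x j (λ a a∈ → α≈0 a∈)) (X+Z≈0 j)

lemma1 : ∀ {c ℓ} (R : CommutativeRing c ℓ) → IsField R →
    (q : ℕ) (enum : Fin q → CommutativeRing.Carrier R) → IsEnumeration R q enum →
    (r : ℕ) → 1 ≤ r →
    (n : ℕ) (H : Fin r → Fin n → CommutativeRing.Carrier R) → IsHammingMatrix R q enum r n H →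
    (τ : Pt R q enum r ↔ Pt R q enum r) (o : Pt R q enum r) →
    IsZeroPt R q enum o → Inverse.to τ o ≡ o →
    (x : Pt R q enum r → Fin n → CommutativeRing.Carrier R) →
    (∀ a → InCa R q enum r n H (vecOf R q enum a) (x a)) →
    (k : ℕ) (z : Fin k → Fin n → CommutativeRing.Carrier R) →
    IsBasis R q enum (InC R q enum r n H) z →
    (l : ℕ) (v : Fin l → Pt R q enum r → CommutativeRing.Carrier R) →
    (∃ λ (m : ℕ) → ∃ λ (w : Fin m → Pt R q enum r → CommutativeRing.Carrier R) →
       IsBasis R q enum (λ y → InD R q enum r y × InτD R q enum r τ y) w
       × IsBasis R q enum (InD R q enum r) (w ++ v)) →
    LinIndep R q enum (familyIndex R q enum r k l o) (family R q enum r τ o x z v)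
lemma1 R _ q enum _ r _ n H _ τ o o≈0 τo≡o x x∈C k z z-basis l v (m , w , w-basis , wv-basis) coef relation = coef≈0
  where
  open Relation R q enum r n H τ o o≈0 τo≡o x x∈C k z z-basis l v m w w-basis wv-basis coef relation
  open Code R q enum r using (inj₁∈familyIndex⇒∈nonzeroPts)

  coef≈0 : ∀ t → t ∈ familyIndex R q enum r k l o → CommutativeRing._≈_ R (coef t) (CommutativeRing.0# R)
  coef≈0 (inj₁ a)        a∈ = α≈0 (inj₁∈familyIndex⇒∈nonzeroPts a∈)
  coef≈0 (inj₂ (inj₁ i)) _  = β≈0 i
  coef≈0 (inj₂ (inj₂ j)) _  = γ≈0 j
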